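{- Let $n\ge2$ and let $K_n$ be the number of non-colourable strings in $\{0,1\}^n$. If $n$ is even then $K_n=\frac{2^n+8}{6}$; if $n$ is odd then $K_n=\frac{2^n+16}{6}$.
   Context: $\#w$ is the length, $\varepsilon$ the empty string; for $\#w\ge1$, $l(w)$ is $w$ without its last letter and $r(w)$ is $w$ without its first letter. $T^n$ is the alternating string of length $n$ starting with $0$ ($T^0=\varepsilon$, $T^n=T^{n-1}0$ for odd $n$, $T^n=T^{n-1}1$ for even $n\ge2$) and $CT^n$ its letterwise complement. $\xi$: $\xi(\varepsilon)=0$; $\xi(w)=1$ if $w=T^k$, $k\ge2$ even; $\xi(w)=-1$ if $w=CT^k$, $k\ge2$ even; otherwise $\xi(w)=\operatorname{sgn}(\xi(l(w))+\xi(r(w)))$. $\phi$: $\phi(\varepsilon)=0$; $\phi(w)=-1$ if $w=0^k$, $k$ odd; $\phi(w)=1$ if $w=1^k$, $k$ odd; otherwise $\phi(w)=\operatorname{sgn}(\phi(r(w))-\phi(l(w)))$. $\psi(w)=\xi(w)^{\#w}\phi(w)$ (with $0^0=1$); $w$ is colourable iff $\psi(w)\ne0$. $K_n=\#\{w\in\{0,1\}^n:\psi(w)=0\}$. -}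

module Defs where

open import Data.Bool using (Bool; true; false; not; if_then_else_; _∧_)
open import Data.Bool.Properties using () renaming (_≟_ to _≟ᵇ_)
open import Data.Nat as ℕ using (ℕ; zero; suc)
open import Data.Nat.Divisibility using (_∣?_)
open import Data.Integer as ℤ using (ℤ; +_; -[1+_]; _+_; _-_; _*_; _^_; -_)
open import Data.Vec using (Vec; []; _∷_; _∷ʳ_; init; tail; replicate; map)
open import Data.Vec.Properties using (≡-dec)
open import Data.List using (List; _++_; length; filter)
open import Data.List using ([]; _∷_)
import Data.List as L
open import Relation.Nullary using (yes; no; Dec; ¬_)
open import Relation.Nullary.Decidable using (⌊_⌋)
open import Relation.Binary.PropositionalEquality using (_≡_)

-- Strings over {0,1}: Vec Bool n, with false = letter 0 and true = letter 1.
Str : ℕ → Set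
Str = Vec Bool

_≟w_ : ∀ {n} (u v : Str n) → Dec (u ≡ v)
_≟w_ = ≡-dec _≟ᵇ_

l : ∀ {n} → Str (suc n) → Str n
l w = init w

r : ∀ {n} → Str (suc n) → Str n
r w = tail w

isEven : ℕ → Bool
isEven n = ⌊ 2 ∣? n ⌋

-- T^n : alternating string of length n starting with 0
T : (n : ℕ) → Str n
T zero = []
T (suc n) = T n ∷ʳ (if isEven (suc n) then true else false)

CT : (n : ℕ) → Str n
CT n = map not (T n)

sgn : ℤ → ℤ
sgn (+ zero) = + 0
sgn (+ suc _) = + 1
sgn -[1+ _ ] = - (+ 1)

evenAtLeast2 : ℕ → Bool
evenAtLeast2 k = isEven k ∧ (2 ℕ.≤ᵇ k)

isOdd : ℕ → Bool
isOdd k = not (isEven k)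

ξ : (n : ℕ) → Str n → ℤ
ξ zero w = + 0
ξ (suc n) w with evenAtLeast2 (suc n) | w ≟w T (suc n) | w ≟w CT (suc n)
... | true  | yes _ | _     = + 1
... | true  | no _  | yes _ = - (+ 1)
... | _     | _     | _     = sgn (ξ n (l w) + ξ n (r w))

φ : (n : ℕ) → Str n → ℤ
φ zero w = + 0
φ (suc n) w with isOdd (suc n) | w ≟w replicate (suc n) false | w ≟w replicate (suc n) true
... | true  | yes _ | _     = - (+ 1)
... | true  | no _  | yes _ = + 1
... | _     | _     | _     = sgn (φ n (r w) - φ n (l w))

-- ψ(w) = ξ(w)^{#w} φ(w)   (Data.Integer._^_ has 0^0 = 1)
ψ : (n : ℕ) → Str n → ℤ
ψ n w = (ξ n w ^ n) * φ n w

colourable : ∀ {n} → Str n → Set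
colourable {n} w = ¬ (ψ n w ≡ + 0)

allStr : (n : ℕ) → List (Str n)
allStr zero = [] ∷ []
allStr (suc n) = L.map (false ∷_) (allStr n) ++ L.map (true ∷_) (allStr n)

K : ℕ → ℕ
K n = length (filter (λ w → ψ n w ℤ.≟ + 0) (allStr n))

-- Call a string generic if it is neither constant nor alternating.  For generic w of length at
-- least 3 and letters a, b we have ξ(a w b) = ξ(w) and φ(a w b) = -φ(w), by induction on the
-- length: l(a w b) and r(a w b) are l(w) and r(w) extended by one letter on each side, so the
-- induction hypothesis applies unless l(w) or r(w) is constant or alternating, in which case w is
-- one of four explicit strings whose values are computed directly.  Hence a w b is colourable iff
-- w is.  For the four special strings w of length n >= 3 a direct computation shows that a w b is
-- non-colourable iff a = b and w is non-colourable; the constant strings are non-colourable, the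
-- alternating ones iff n is odd.  Counting strings of length n + 2 by their first and last letters
-- gives K(n+2) + 2 s(n) = 4 K(n) with s(n) = 2 + 2 [n odd], and the closed form follows by
-- induction from K(2) = 2, K(3) = K(4) = 4.

module Submission where

open import Defs
open import Data.Bool using (Bool; true; false; not; if_then_else_; _∧_; _∨_)
open import Data.Bool.Properties
  using (∨-identityʳ; ∧-identityʳ; not-involutive; not-injective; not-¬; ¬-not) renaming (_≟_ to _≟ᵇ_)
open import Data.Empty using (⊥-elim)
open import Data.Integer as ℤ using (ℤ; +_; -_)
open import Data.Integer.Properties using (+-inverseʳ; neg-distrib-+; *-zeroʳ; i*j≡0⇒i≡0∨j≡0; i^n≡0⇒i≡0)
open import Data.Nat using (ℕ; zero; suc; _+_; _*_; _^_; _≤_; s≤s; z≤n)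
open import Data.Nat.Properties using (+-comm; +-assoc; +-cancelʳ-≡; +-commutativeSemigroup)
open import Data.Nat.Solver using (module +-*-Solver)
open import Algebra.Properties.CommutativeSemigroup +-commutativeSemigroup using (interchange; xy∙z≈xz∙y)
open import Data.Nat.Divisibility using (_∣_; _∣?_; ∣m∣n⇒∣m+n; ∣m+n∣m⇒∣n; ∣-refl)
open import Data.Product using (Σ; _×_; _,_; proj₁; proj₂; ∃-syntax)
open import Data.Sum using (_⊎_; inj₁; inj₂)
open import Data.Vec using (Vec; []; _∷_; _∷ʳ_; _++_; init; initLast; replicate; map)
open import Data.Vec.Properties using (init-∷ʳ; ∷-injective; ∷ʳ-injective; ∷ʳ-injectiveˡ)
open import Data.List as List using (length; filter)
open import Data.List.Properties using (filter-++; length-++)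
open import Function using (_∘_)
open import Level using (0ℓ)
open import Relation.Unary using (Pred; Decidable)
open import Relation.Nullary using (Dec; does; yes; no; ¬_)
open import Relation.Nullary.Decidable using (dec-true; dec-false; isYes≗does)
open import Relation.Binary.PropositionalEquality
open +-*-Solver using (solve; _:+_; _:*_; _:=_; con)

even : ℕ → Bool
even zero = true
even (suc n) = not (even n)

isEven≡even : ∀ n → isEven n ≡ even n
isEven≡even zero = refl
isEven≡even (suc zero) = refl
isEven≡even (suc (suc n)) = begin
  isEven (2 + n)     ≡⟨ isEven-+2 ⟩
  isEven n           ≡⟨ isEven≡even n ⟩
  even n             ≡⟨ not-involutive (even n) ⟨
  even (2 + n)       ∎
  where
  open ≡-Reasoning
  isEven-+2 : isEven (2 + n) ≡ isEven n
  isEven-+2 with 2 ∣? n | 2 ∣? (2 + n)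
  ... | yes _  | yes _  = refl
  ... | no _   | no _   = refl
  ... | yes 2∣n | no 2∤n+2 = ⊥-elim (2∤n+2 (∣m∣n⇒∣m+n ∣-refl 2∣n))
  ... | no 2∤n  | yes 2∣n+2 = ⊥-elim (2∤n (∣m+n∣m⇒∣n 2∣n+2 ∣-refl))

even≡does-2∣? : ∀ n → even n ≡ does (2 ∣? n)
even≡does-2∣? n = trans (sym (isEven≡even n)) (isYes≗does (2 ∣? n))

evenAtLeast2-+2 : ∀ m → evenAtLeast2 (2 + m) ≡ even m
evenAtLeast2-+2 m rewrite isEven≡even (2 + m) | not-involutive (even m) with even m
... | true  = refl
... | false = refl

isOdd-suc : ∀ n → isOdd (suc n) ≡ even n
isOdd-suc n rewrite isEven≡even (suc n) = not-involutive (even n)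

alt : Bool → (n : ℕ) → Str n
alt x zero = []
alt x (suc n) = x ∷ alt (not x) n

-- lastAlt x m is the last letter of alt x (suc m).
lastAlt : Bool → ℕ → Bool
lastAlt x zero = x
lastAlt x (suc m) = lastAlt (not x) m

lastAlt-not : ∀ x m → lastAlt (not x) m ≡ not (lastAlt x m)
lastAlt-not x zero = refl
lastAlt-not x (suc m) = lastAlt-not (not x) m

lastAlt≡if : ∀ x m → lastAlt x m ≡ (if even m then x else not x)
lastAlt≡if x zero = refl
lastAlt≡if x (suc m) rewrite lastAlt-not x m | lastAlt≡if x m with even m
... | true  = refl
... | false = not-involutive x

lastAlt-suc≡if : ∀ x m → lastAlt x (suc m) ≡ (if even m then not x else x)
lastAlt-suc≡if x m rewrite lastAlt-not x m | lastAlt≡if x m with even m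
... | true  = refl
... | false = not-involutive x

alt-∷ʳ : ∀ x m → alt x (suc m) ≡ alt x m ∷ʳ lastAlt x m
alt-∷ʳ x zero = refl
alt-∷ʳ x (suc m) = cong (x ∷_) (alt-∷ʳ (not x) m)

alt-∷ʳ-not-last : ∀ m x → alt x (suc m) ∷ʳ not (lastAlt x m) ≡ alt x (2 + m)
alt-∷ʳ-not-last m x = sym (trans (alt-∷ʳ x (suc m)) (cong (alt x (suc m) ∷ʳ_) (lastAlt-not x m)))

not-∷-alt : ∀ x n → not x ∷ alt x n ≡ alt (not x) (suc n)
not-∷-alt x n = cong (λ y → not x ∷ alt y n) (sym (not-involutive x))

init-alt : ∀ x m → init (alt x (suc m)) ≡ alt x m
init-alt x m = trans (cong init (alt-∷ʳ x m)) (init-∷ʳ (lastAlt x m) (alt x m))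

map-not-alt : ∀ x m → map not (alt x m) ≡ alt (not x) m
map-not-alt x zero = refl
map-not-alt x (suc m) = cong (not x ∷_) (map-not-alt (not x) m)

T≡alt : ∀ n → T n ≡ alt false n
T≡alt zero = refl
T≡alt (suc n) = trans (cong₂ _∷ʳ_ (T≡alt n) lastLetter) (sym (alt-∷ʳ false n))
  where
  lastLetter : (if isEven (suc n) then true else false) ≡ lastAlt false n
  lastLetter rewrite isEven≡even (suc n) | lastAlt≡if false n with even n
  ... | true  = refl
  ... | false = refl

CT≡alt : ∀ n → CT n ≡ alt true n
CT≡alt n = trans (cong (map not) (T≡alt n)) (map-not-alt false n)

replicate-∷ʳ : ∀ m (c : Bool) → replicate (suc m) c ≡ replicate m c ∷ʳ c
replicate-∷ʳ zero c = refl
replicate-∷ʳ (suc m) c = cong (c ∷_) (replicate-∷ʳ m c)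

init-replicate : ∀ m (c : Bool) → init (replicate (suc m) c) ≡ replicate m c
init-replicate zero c = refl
init-replicate (suc m) c = cong (c ∷_) (init-replicate m c)

init-∷-∷ʳ : ∀ {m} x (v : Str m) y → init (x ∷ (v ∷ʳ y)) ≡ x ∷ v
init-∷-∷ʳ x v y = cong (x ∷_) (init-∷ʳ y v)

split-ends : ∀ {n} (w : Str (2 + n)) → ∃[ x ] Σ (Str n) λ m → ∃[ y ] w ≡ x ∷ (m ∷ʳ y)
split-ends (x ∷ v) with m , y , refl ← initLast v = x , m , y , refl

Alternating : ∀ {n} → Str n → Set
Alternating {n} w = ∃[ x ] w ≡ alt x n

Constant : ∀ {n} → Str n → Set
Constant {n} w = ∃[ c ] w ≡ replicate n c

Generic : ∀ {n} → Str n → Set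
Generic w = ¬ Alternating w × ¬ Constant w

∃ᵇ? : {P : Bool → Set} → (∀ x → Dec (P x)) → Dec (∃[ x ] P x)
∃ᵇ? P? with P? false | P? true
... | yes p | _     = yes (false , p)
... | no _  | yes p = yes (true , p)
... | no ¬p | no ¬q = no λ { (false , p) → ¬p p ; (true , q) → ¬q q }

alternating? : ∀ {n} (w : Str n) → Dec (Alternating w)
alternating? {n} w = ∃ᵇ? (λ x → w ≟w alt x n)

constant? : ∀ {n} (w : Str n) → Dec (Constant w)
constant? {n} w = ∃ᵇ? (λ c → w ≟w replicate n c)

alternating-tail : ∀ {n} {a} {w : Str n} → Alternating (a ∷ w) → Alternating w
alternating-tail (x , refl) = not x , refl

alternating-init : ∀ {n} {b} (w : Str n) → Alternating (w ∷ʳ b) → Alternating w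
alternating-init {n} {b} w (x , w∷ʳb≡alt) =
  x , ∷ʳ-injectiveˡ w (alt x n) (trans w∷ʳb≡alt (alt-∷ʳ x n))

¬alternating-∷-∷ : ∀ {n} c (u : Str n) → ¬ Alternating (c ∷ c ∷ u)
¬alternating-∷-∷ c u (x , eq) with ∷-injective eq
... | refl , eq′ = not-¬ refl (proj₁ (∷-injective eq′))

¬alternating-∷-not : ∀ {n} x {u : Str n} → u ≢ alt x n → ¬ Alternating (x ∷ not x ∷ u)
¬alternating-∷-not {n} x u≢ (z , eq) with refl , eq′ ← ∷-injective eq =
  u≢ (trans (proj₂ (∷-injective eq′)) (cong (λ y → alt y n) (not-involutive x)))

¬alternating-∷ʳ-last : ∀ m x → ¬ Alternating (alt x (suc m) ∷ʳ lastAlt x m)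
¬alternating-∷ʳ-last m x (z , eq)
  with ∷ʳ-injective (alt x (suc m)) (alt z (suc m)) (trans eq (alt-∷ʳ z (suc m)))
... | alt≡alt , last≡last with ∷-injective alt≡alt
... | refl , _ = not-¬ refl (trans last≡last (lastAlt-not x m))

constant-tail : ∀ {n} {a} {w : Str n} → Constant (a ∷ w) → Constant w
constant-tail (c , refl) = c , refl

constant-init : ∀ {n} {b} (w : Str n) → Constant (w ∷ʳ b) → Constant w
constant-init {n} {b} w (c , w∷ʳb≡rep) =
  c , ∷ʳ-injectiveˡ w (replicate n c) (trans w∷ʳb≡rep (replicate-∷ʳ n c))

¬constant-∷-∷ : ∀ {n} c {u : Str n} → u ≢ replicate n c → ¬ Constant (c ∷ c ∷ u)
¬constant-∷-∷ c u≢ (z , eq) with refl , eq′ ← ∷-injective eq = u≢ (proj₂ (∷-injective eq′))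

¬constant-∷-not : ∀ {n} x (u : Str n) → ¬ Constant (x ∷ not x ∷ u)
¬constant-∷-not x u (c , eq) with ∷-injective eq
... | refl , eq′ = not-¬ refl (sym (proj₁ (∷-injective eq′)))

¬constant-not-∷ : ∀ {n} x (u : Str n) → ¬ Constant (not x ∷ x ∷ u)
¬constant-not-∷ x u (c , eq) with ∷-injective eq
... | refl , eq′ = not-¬ refl (proj₁ (∷-injective eq′))

¬constant-replicate-∷ʳ-not : ∀ m c → ¬ Constant (replicate (suc m) c ∷ʳ not c)
¬constant-replicate-∷ʳ-not m c (z , eq)
  with ∷ʳ-injective (replicate (suc m) c) (replicate (suc m) z) (trans eq (replicate-∷ʳ (suc m) z))
... | rep≡rep , not-c≡z with ∷-injective rep≡rep
... | refl , _ = not-¬ refl (sym not-c≡z)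

generic-alt-∷ʳ-last : ∀ m x → Generic (alt x (2 + m) ∷ʳ lastAlt x (1 + m))
generic-alt-∷ʳ-last m x = ¬alternating-∷ʳ-last (1 + m) x , ¬constant-∷-not x _

generic-replicate-∷ʳ-not : ∀ m c → Generic (replicate (2 + m) c ∷ʳ not c)
generic-replicate-∷ʳ-not m c = ¬alternating-∷-∷ c _ , ¬constant-replicate-∷ʳ-not (suc m) c

generic-∷-alt : ∀ m x → Generic (x ∷ alt x (2 + m))
generic-∷-alt m x = ¬alternating-∷-∷ x _ , ¬constant-∷-not x _ ∘ constant-tail

generic-not-∷-replicate : ∀ m c → Generic (not c ∷ replicate (2 + m) c)
generic-not-∷-replicate m c = ¬alternating-∷-∷ c _ ∘ alternating-tail , ¬constant-not-∷ c _

-- v ++ specialTail n v is the constant or alternating string beginning with v;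
-- every other string beginning with v is generic.
specialTail : ∀ n → Str 2 → Str n
specialTail n (false ∷ false ∷ []) = replicate n false
specialTail n (false ∷ true ∷ []) = alt false n
specialTail n (true ∷ false ∷ []) = alt true n
specialTail n (true ∷ true ∷ []) = replicate n true

generic-unless-special : ∀ {n} (v : Str 2) (u : Str n) → u ≢ specialTail n v → Generic (v ++ u)
generic-unless-special (false ∷ false ∷ []) u u≢ = ¬alternating-∷-∷ false u , ¬constant-∷-∷ false u≢
generic-unless-special (false ∷ true ∷ []) u u≢ = ¬alternating-∷-not false u≢ , ¬constant-∷-not false u
generic-unless-special (true ∷ false ∷ []) u u≢ = ¬alternating-∷-not true u≢ , ¬constant-∷-not true u
generic-unless-special (true ∷ true ∷ []) u u≢ = ¬alternating-∷-∷ true u , ¬constant-∷-∷ true u≢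

sign : Bool → ℤ
sign true = + 1
sign false = - + 1

sign-not : ∀ e → sign (not e) ≡ - sign e
sign-not true = refl
sign-not false = refl

ZeroOr : ℤ → ℤ → Set
ZeroOr s a = a ≡ + 0 ⊎ a ≡ s

zeroOr-≡ : ∀ {s a b} → a ≡ b → ZeroOr s b → ZeroOr s a
zeroOr-≡ a≡b (inj₁ b≡0) = inj₁ (trans a≡b b≡0)
zeroOr-≡ a≡b (inj₂ b≡s) = inj₂ (trans a≡b b≡s)

sgn-absorbʳ : ∀ e {a} → ZeroOr (sign e) a → sgn (a ℤ.+ sign e) ≡ sign e
sgn-absorbʳ true (inj₁ refl) = refl
sgn-absorbʳ false (inj₁ refl) = refl
sgn-absorbʳ true (inj₂ refl) = refl
sgn-absorbʳ false (inj₂ refl) = refl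

sgn-absorbˡ : ∀ e {a} → ZeroOr (sign e) a → sgn (sign e ℤ.+ a) ≡ sign e
sgn-absorbˡ true (inj₁ refl) = refl
sgn-absorbˡ false (inj₁ refl) = refl
sgn-absorbˡ true (inj₂ refl) = refl
sgn-absorbˡ false (inj₂ refl) = refl

sgn-absorbʳ-≡ : ∀ e {a b c} → ZeroOr (sign e) a → b ≡ sign e → c ≡ sign e → sgn (a ℤ.+ b) ≡ c
sgn-absorbʳ-≡ e a∈ refl refl = sgn-absorbʳ e a∈

sgn-absorbˡ-≡ : ∀ e {a b c} → a ≡ sign e → ZeroOr (sign e) b → c ≡ sign e → sgn (a ℤ.+ b) ≡ c
sgn-absorbˡ-≡ e refl b∈ refl = sgn-absorbˡ e b∈

sgn-absorb-−ˡ : ∀ e {a} → ZeroOr (sign e) a → sgn (sign (not e) ℤ.- a) ≡ sign (not e)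
sgn-absorb-−ˡ true (inj₁ refl) = refl
sgn-absorb-−ˡ false (inj₁ refl) = refl
sgn-absorb-−ˡ true (inj₂ refl) = refl
sgn-absorb-−ˡ false (inj₂ refl) = refl

sgn-absorb-−ʳ : ∀ e {b} → ZeroOr (sign (not e)) b → sgn (b ℤ.- sign e) ≡ sign (not e)
sgn-absorb-−ʳ true (inj₁ refl) = refl
sgn-absorb-−ʳ false (inj₁ refl) = refl
sgn-absorb-−ʳ true (inj₂ refl) = refl
sgn-absorb-−ʳ false (inj₂ refl) = refl

sgn-sign-+ˡ : ∀ x y → ZeroOr (sign x) (sgn (sign x ℤ.+ sign y))
sgn-sign-+ˡ false false = inj₂ refl
sgn-sign-+ˡ false true = inj₁ refl
sgn-sign-+ˡ true false = inj₁ refl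
sgn-sign-+ˡ true true = inj₂ refl

sgn-sign-+ʳ : ∀ x y → ZeroOr (sign y) (sgn (sign x ℤ.+ sign y))
sgn-sign-+ʳ false false = inj₂ refl
sgn-sign-+ʳ false true = inj₁ refl
sgn-sign-+ʳ true false = inj₁ refl
sgn-sign-+ʳ true true = inj₂ refl

sgn-sign-+-sign-not : ∀ y → sgn (sign y ℤ.+ sign (not y)) ≡ + 0
sgn-sign-+-sign-not true = refl
sgn-sign-+-sign-not false = refl

sgn-sign-−ˡ : ∀ x y → ZeroOr (sign x) (sgn (sign x ℤ.- sign y))
sgn-sign-−ˡ false false = inj₁ refl
sgn-sign-−ˡ false true = inj₂ refl
sgn-sign-−ˡ true false = inj₂ refl
sgn-sign-−ˡ true true = inj₁ refl

sgn-sign-−ʳ : ∀ x y → ZeroOr (sign (not y)) (sgn (sign x ℤ.- sign y))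
sgn-sign-−ʳ false false = inj₁ refl
sgn-sign-−ʳ false true = inj₂ refl
sgn-sign-−ʳ true false = inj₂ refl
sgn-sign-−ʳ true true = inj₁ refl

sgn-neg : ∀ z → sgn (- z) ≡ - sgn z
sgn-neg (+ zero) = refl
sgn-neg (+ suc n) = refl
sgn-neg ℤ.-[1+ n ] = refl

sgn-neg-−-neg : ∀ p q → sgn (- p ℤ.- - q) ≡ - sgn (p ℤ.- q)
sgn-neg-−-neg p q = trans (cong sgn (sym (neg-distrib-+ p (- q)))) (sgn-neg (p ℤ.- q))

-- The function ξ

ξ-step : ∀ {n} (w : Str (suc n)) → ¬ Alternating w → ξ (suc n) w ≡ sgn (ξ n (l w) ℤ.+ ξ n (r w))
ξ-step {n} w ¬alt with evenAtLeast2 (suc n) | w ≟w T (suc n) | w ≟w CT (suc n)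
... | true  | yes w≡T | _       = ⊥-elim (¬alt (false , trans w≡T (T≡alt _)))
... | true  | no _    | yes w≡CT = ⊥-elim (¬alt (true , trans w≡CT (CT≡alt _)))
... | true  | no _    | no _    = refl
... | false | _       | _       = refl

ξ-step-∷-∷ʳ : ∀ {n} a (v : Str n) b → ¬ Alternating (a ∷ (v ∷ʳ b)) →
              ξ (2 + n) (a ∷ (v ∷ʳ b)) ≡ sgn (ξ (suc n) (a ∷ v) ℤ.+ ξ (suc n) (v ∷ʳ b))
ξ-step-∷-∷ʳ {n} a v b ¬alt =
  trans (ξ-step (a ∷ (v ∷ʳ b)) ¬alt)
        (cong (λ u → sgn (ξ (suc n) u ℤ.+ ξ (suc n) (v ∷ʳ b))) (init-∷-∷ʳ a v b))

ξ-step-oddLength : ∀ {n} (w : Str (suc n)) → evenAtLeast2 (suc n) ≡ false →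
                   ξ (suc n) w ≡ sgn (ξ n (l w) ℤ.+ ξ n (r w))
ξ-step-oddLength {n} w odd with evenAtLeast2 (suc n) | w ≟w T (suc n) | w ≟w CT (suc n)
ξ-step-oddLength w () | true | _ | _
... | false | _ | _ = refl

ξ-alt-evenLength : ∀ {n} x → evenAtLeast2 (suc n) ≡ true → ξ (suc n) (alt x (suc n)) ≡ sign (not x)
ξ-alt-evenLength {n} x ev with evenAtLeast2 (suc n) | alt x (suc n) ≟w T (suc n) | alt x (suc n) ≟w CT (suc n)
ξ-alt-evenLength x () | false | _ | _
ξ-alt-evenLength false _ | true | yes _ | _ = refl
ξ-alt-evenLength false _ | true | no alt≢T | _ = ⊥-elim (alt≢T (sym (T≡alt _)))
ξ-alt-evenLength true _ | true | yes alt≡T | _ = ⊥-elim (alt-true≢alt-false (trans alt≡T (T≡alt _)))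
  where
  alt-true≢alt-false : alt true (suc _) ≢ alt false (suc _)
  alt-true≢alt-false ()
ξ-alt-evenLength true _ | true | no _ | yes _ = refl
ξ-alt-evenLength true _ | true | no _ | no alt≢CT = ⊥-elim (alt≢CT (sym (CT≡alt _)))

ξ-alt : ∀ m x → ξ (2 + m) (alt x (2 + m)) ≡ (if even m then sign (not x) else + 0)
ξ-alt m x with even m in ev
... | true = ξ-alt-evenLength {suc m} x (trans (evenAtLeast2-+2 m) ev)
ξ-alt (suc m) x | false = begin
  ξ (3 + m) (alt x (3 + m))
    ≡⟨ ξ-step-oddLength (alt x (3 + m)) (trans (evenAtLeast2-+2 (suc m)) ev) ⟩
  sgn (ξ (2 + m) (init (alt x (3 + m))) ℤ.+ ξ (2 + m) (alt (not x) (2 + m)))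
    ≡⟨ cong (λ v → sgn (ξ (2 + m) v ℤ.+ ξ (2 + m) (alt (not x) (2 + m)))) (init-alt x (2 + m)) ⟩
  sgn (ξ (2 + m) (alt x (2 + m)) ℤ.+ ξ (2 + m) (alt (not x) (2 + m)))
    ≡⟨ cong₂ (λ a b → sgn (a ℤ.+ b)) (ξ-alt m x) (ξ-alt m (not x)) ⟩
  sgn ((if even m then sign (not x) else + 0) ℤ.+ (if even m then sign (not (not x)) else + 0))
    ≡⟨ cong (λ e → sgn ((if e then sign (not x) else + 0) ℤ.+ (if e then sign (not (not x)) else + 0)))
            (not-injective ev) ⟩
  sgn (sign (not x) ℤ.+ sign (not (not x)))
    ≡⟨ sgn-sign-+-sign-not (not x) ⟩
  + 0 ∎
  where
  open ≡-Reasoning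

ξ-alt-zeroOr : ∀ m x → ZeroOr (sign (not x)) (ξ (2 + m) (alt x (2 + m)))
ξ-alt-zeroOr m x rewrite ξ-alt m x with even m
... | true  = inj₂ refl
... | false = inj₁ refl

ξ-alt-zeroOr-last : ∀ m x → ZeroOr (sign (lastAlt x (suc m))) (ξ (2 + m) (alt x (2 + m)))
ξ-alt-zeroOr-last m x rewrite ξ-alt m x | lastAlt-not x m | lastAlt≡if x m with even m
... | true  = inj₂ refl
... | false = inj₁ refl

ξ-replicate : ∀ m c → ξ m (replicate m c) ≡ + 0
ξ-replicate zero c = refl
ξ-replicate (suc zero) c = refl
ξ-replicate (suc (suc m)) c = begin
  ξ (2 + m) (replicate (2 + m) c)
    ≡⟨ ξ-step (replicate (2 + m) c) (¬alternating-∷-∷ c (replicate m c)) ⟩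
  sgn (ξ (suc m) (init (replicate (2 + m) c)) ℤ.+ ξ (suc m) (replicate (suc m) c))
    ≡⟨ cong (λ v → sgn (ξ (suc m) v ℤ.+ ξ (suc m) (replicate (suc m) c))) (init-replicate (suc m) c) ⟩
  sgn (ξ (suc m) (replicate (suc m) c) ℤ.+ ξ (suc m) (replicate (suc m) c))
    ≡⟨ cong (λ a → sgn (a ℤ.+ a)) (ξ-replicate (suc m) c) ⟩
  + 0 ∎
  where open ≡-Reasoning

ξ-alt-∷ʳ-last : ∀ j x → ξ (3 + j) (alt x (2 + j) ∷ʳ lastAlt x (1 + j)) ≡ sign (lastAlt x (1 + j))
ξ-alt-∷ʳ-last zero true = refl
ξ-alt-∷ʳ-last zero false = refl
ξ-alt-∷ʳ-last (suc j) x = begin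
  ξ (4 + j) (alt x (3 + j) ∷ʳ lastAlt x (2 + j))
    ≡⟨ ξ-step-∷-∷ʳ x (alt (not x) (2 + j)) _ (¬alternating-∷ʳ-last (2 + j) x) ⟩
  sgn (ξ (3 + j) (alt x (3 + j)) ℤ.+ ξ (3 + j) (alt (not x) (2 + j) ∷ʳ lastAlt (not x) (1 + j)))
    ≡⟨ cong (λ b → sgn (ξ (3 + j) (alt x (3 + j)) ℤ.+ b)) (ξ-alt-∷ʳ-last j (not x)) ⟩
  sgn (ξ (3 + j) (alt x (3 + j)) ℤ.+ sign (lastAlt x (2 + j)))
    ≡⟨ sgn-absorbʳ (lastAlt x (2 + j)) (ξ-alt-zeroOr-last (suc j) x) ⟩
  sign (lastAlt x (2 + j)) ∎
  where open ≡-Reasoning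

ξ-∷-alt : ∀ j x → ξ (3 + j) (x ∷ alt x (2 + j)) ≡ sign (not x)
ξ-∷-alt zero true = refl
ξ-∷-alt zero false = refl
ξ-∷-alt (suc j) x = begin
  ξ (4 + j) (x ∷ alt x (3 + j))
    ≡⟨ ξ-step (x ∷ alt x (3 + j)) (¬alternating-∷-∷ x _) ⟩
  sgn (ξ (3 + j) (x ∷ init (alt x (3 + j))) ℤ.+ ξ (3 + j) (alt x (3 + j)))
    ≡⟨ cong (λ u → sgn (ξ (3 + j) (x ∷ u) ℤ.+ ξ (3 + j) (alt x (3 + j)))) (init-alt x (2 + j)) ⟩
  sgn (ξ (3 + j) (x ∷ alt x (2 + j)) ℤ.+ ξ (3 + j) (alt x (3 + j)))
    ≡⟨ cong (λ a → sgn (a ℤ.+ ξ (3 + j) (alt x (3 + j)))) (ξ-∷-alt j x) ⟩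
  sgn (sign (not x) ℤ.+ ξ (3 + j) (alt x (3 + j)))
    ≡⟨ sgn-absorbˡ (not x) (ξ-alt-zeroOr (suc j) x) ⟩
  sign (not x) ∎
  where open ≡-Reasoning

ξ-∷-alt-∷ʳ-last : ∀ j x → ξ (4 + j) (x ∷ (alt x (2 + j) ∷ʳ lastAlt x (1 + j)))
                           ≡ sgn (sign (not x) ℤ.+ sign (lastAlt x (1 + j)))
ξ-∷-alt-∷ʳ-last j x = begin
  ξ (4 + j) (x ∷ (alt x (2 + j) ∷ʳ lastAlt x (1 + j)))
    ≡⟨ ξ-step-∷-∷ʳ x (alt x (2 + j)) _ (¬alternating-∷-∷ x _) ⟩
  sgn (ξ (3 + j) (x ∷ alt x (2 + j)) ℤ.+ ξ (3 + j) (alt x (2 + j) ∷ʳ lastAlt x (1 + j)))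
    ≡⟨ cong₂ (λ a b → sgn (a ℤ.+ b)) (ξ-∷-alt j x) (ξ-alt-∷ʳ-last j x) ⟩
  sgn (sign (not x) ℤ.+ sign (lastAlt x (1 + j))) ∎
  where open ≡-Reasoning

ξ-replicate-∷ʳ-not : ∀ k c → ξ (2 + k) (replicate (1 + k) c ∷ʳ not c) ≡ sign (not c)
ξ-replicate-∷ʳ-not zero true = refl
ξ-replicate-∷ʳ-not zero false = refl
ξ-replicate-∷ʳ-not (suc k) c = begin
  ξ (3 + k) (c ∷ (replicate (1 + k) c ∷ʳ not c))
    ≡⟨ ξ-step-∷-∷ʳ c (replicate (1 + k) c) (not c) (¬alternating-∷-∷ c _) ⟩
  sgn (ξ (2 + k) (replicate (2 + k) c) ℤ.+ ξ (2 + k) (replicate (1 + k) c ∷ʳ not c))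
    ≡⟨ cong₂ (λ a b → sgn (a ℤ.+ b)) (ξ-replicate (2 + k) c) (ξ-replicate-∷ʳ-not k c) ⟩
  sgn (+ 0 ℤ.+ sign (not c))
    ≡⟨ sgn-absorbʳ (not c) (inj₁ refl) ⟩
  sign (not c) ∎
  where open ≡-Reasoning

ξ-not-∷-replicate : ∀ k c → ξ (2 + k) (not c ∷ replicate (1 + k) c) ≡ sign c
ξ-not-∷-replicate zero true = refl
ξ-not-∷-replicate zero false = refl
ξ-not-∷-replicate (suc k) c = begin
  ξ (3 + k) (not c ∷ replicate (2 + k) c)
    ≡⟨ ξ-step (not c ∷ replicate (2 + k) c) (¬alternating-∷-∷ c _ ∘ alternating-tail) ⟩
  sgn (ξ (2 + k) (not c ∷ init (replicate (2 + k) c)) ℤ.+ ξ (2 + k) (replicate (2 + k) c))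
    ≡⟨ cong₂ (λ a b → sgn (a ℤ.+ b))
             (trans (cong (λ u → ξ (2 + k) (not c ∷ u)) (init-replicate (1 + k) c)) (ξ-not-∷-replicate k c))
             (ξ-replicate (2 + k) c) ⟩
  sgn (sign c ℤ.+ + 0)
    ≡⟨ sgn-absorbˡ c (inj₁ refl) ⟩
  sign c ∎
  where open ≡-Reasoning

ξ-not-∷-replicate-∷ʳ-not : ∀ k c → ξ (3 + k) (not c ∷ (replicate (1 + k) c ∷ʳ not c)) ≡ + 0
ξ-not-∷-replicate-∷ʳ-not zero true = refl
ξ-not-∷-replicate-∷ʳ-not zero false = refl
ξ-not-∷-replicate-∷ʳ-not (suc k) c = begin
  ξ (4 + k) (not c ∷ (replicate (2 + k) c ∷ʳ not c))
    ≡⟨ ξ-step-∷-∷ʳ (not c) (replicate (2 + k) c) (not c) (¬alternating-∷-∷ c _ ∘ alternating-tail) ⟩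
  sgn (ξ (3 + k) (not c ∷ replicate (2 + k) c) ℤ.+ ξ (3 + k) (replicate (2 + k) c ∷ʳ not c))
    ≡⟨ cong₂ (λ a b → sgn (a ℤ.+ b)) (ξ-not-∷-replicate (suc k) c) (ξ-replicate-∷ʳ-not (suc k) c) ⟩
  sgn (sign c ℤ.+ sign (not c))
    ≡⟨ sgn-sign-+-sign-not c ⟩
  + 0 ∎
  where open ≡-Reasoning

ξ-Extendable : ∀ {n} → Str n → Set
ξ-Extendable {n} w = ∀ a b → ξ (2 + n) (a ∷ (w ∷ʳ b)) ≡ ξ n w

ξ-extend-base : ∀ (w : Str 3) → Generic w → ξ-Extendable w
ξ-extend-base (false ∷ false ∷ false ∷ []) (_ , ¬const) = ⊥-elim (¬const (false , refl))
ξ-extend-base (true ∷ true ∷ true ∷ []) (_ , ¬const) = ⊥-elim (¬const (true , refl))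
ξ-extend-base (false ∷ true ∷ false ∷ []) (¬alt , _) = ⊥-elim (¬alt (false , refl))
ξ-extend-base (true ∷ false ∷ true ∷ []) (¬alt , _) = ⊥-elim (¬alt (true , refl))
ξ-extend-base (false ∷ false ∷ true ∷ []) _ =
  λ { false false → refl ; false true → refl ; true false → refl ; true true → refl }
ξ-extend-base (false ∷ true ∷ true ∷ []) _ =
  λ { false false → refl ; false true → refl ; true false → refl ; true true → refl }
ξ-extend-base (true ∷ false ∷ false ∷ []) _ =
  λ { false false → refl ; false true → refl ; true false → refl ; true true → refl }
ξ-extend-base (true ∷ true ∷ false ∷ []) _ =
  λ { false false → refl ; false true → refl ; true false → refl ; true true → refl }

-- When l(w) or r(w) is special, one side of a ∷ w ∷ʳ b has ξ = ξ w ∈ {±1}, the other ξ ∈ {0, ξ w}.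
module ξ-ExtendStep (k : ℕ) (ih : ∀ (w : Str (3 + k)) → Generic w → ξ-Extendable w) where

  Halves : Str (4 + k) → Set
  Halves w = ∀ a b → sgn (ξ (5 + k) (a ∷ w) ℤ.+ ξ (5 + k) (w ∷ʳ b)) ≡ ξ (4 + k) w

  halves-alt-∷ʳ-last : ∀ x → Halves (alt x (3 + k) ∷ʳ lastAlt x (2 + k))
  halves-alt-∷ʳ-last x a b =
    sgn-absorbʳ-≡ (lastAlt x (2 + k)) (left a x)
      (trans (ih (alt (not x) (2 + k) ∷ʳ _) (generic-alt-∷ʳ-last k (not x)) x b) (ξ-alt-∷ʳ-last k (not x)))
      (ξ-alt-∷ʳ-last (suc k) x)
    where
    doubledBoth : ∀ x → ZeroOr (sign (lastAlt x (2 + k))) (ξ (5 + k) (x ∷ (alt x (3 + k) ∷ʳ lastAlt x (2 + k))))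
    doubledBoth x = zeroOr-≡ (ξ-∷-alt-∷ʳ-last (suc k) x) (sgn-sign-+ʳ (not x) (lastAlt x (2 + k)))
    left : ∀ a x → ZeroOr (sign (lastAlt x (2 + k))) (ξ (5 + k) (a ∷ (alt x (3 + k) ∷ʳ lastAlt x (2 + k))))
    left false false = doubledBoth false
    left true true = doubledBoth true
    left false true = inj₂ (ξ-alt-∷ʳ-last (2 + k) false)
    left true false = inj₂ (ξ-alt-∷ʳ-last (2 + k) true)

  halves-replicate-∷ʳ-not : ∀ c → Halves (replicate (3 + k) c ∷ʳ not c)
  halves-replicate-∷ʳ-not c a b =
    sgn-absorbʳ-≡ (not c) (left a)
      (trans (ih (replicate (2 + k) c ∷ʳ not c) (generic-replicate-∷ʳ-not k c) c b) (ξ-replicate-∷ʳ-not (suc k) c))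
      (ξ-replicate-∷ʳ-not (2 + k) c)
    where
    left : ∀ a → ZeroOr (sign (not c)) (ξ (5 + k) (a ∷ (replicate (3 + k) c ∷ʳ not c)))
    left a with a ≟ᵇ c
    ... | yes refl = inj₂ (ξ-replicate-∷ʳ-not (3 + k) c)
    ... | no a≢c rewrite ¬-not a≢c = inj₁ (ξ-not-∷-replicate-∷ʳ-not (2 + k) c)

  halves-∷-alt : ∀ x → Halves (x ∷ (alt x (2 + k) ∷ʳ lastAlt x (2 + k)))
  halves-∷-alt x a b =
    sgn-absorbˡ-≡ (not x)
      (trans (ih (x ∷ alt x (2 + k)) (generic-∷-alt k x) a ℓ) (ξ-∷-alt k x))
      (zeroOr-≡ (cong (λ v → ξ (5 + k) (v ∷ʳ b)) w≡) (right b))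
      (trans (cong (ξ (4 + k)) w≡) (ξ-∷-alt (suc k) x))
    where
    ℓ = lastAlt x (2 + k)
    w≡ : x ∷ (alt x (2 + k) ∷ʳ ℓ) ≡ x ∷ alt x (3 + k)
    w≡ = cong (x ∷_) (sym (alt-∷ʳ x (2 + k)))
    right : ∀ b → ZeroOr (sign (not x)) (ξ (5 + k) (x ∷ (alt x (3 + k) ∷ʳ b)))
    right b with b ≟ᵇ ℓ
    ... | yes refl = zeroOr-≡ (ξ-∷-alt-∷ʳ-last (suc k) x) (sgn-sign-+ˡ (not x) ℓ)
    ... | no b≢ℓ = inj₂ (trans (cong (λ v → ξ (5 + k) (x ∷ v)) alt-∷ʳ-b) (ξ-∷-alt (2 + k) x))
      where
      alt-∷ʳ-b : alt x (3 + k) ∷ʳ b ≡ alt x (4 + k)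
      alt-∷ʳ-b = trans (cong (alt x (3 + k) ∷ʳ_) (¬-not b≢ℓ)) (alt-∷ʳ-not-last (2 + k) x)

  halves-not-∷-replicate : ∀ c → Halves (not c ∷ (replicate (2 + k) c ∷ʳ c))
  halves-not-∷-replicate c a b =
    sgn-absorbˡ-≡ c
      (trans (ih (not c ∷ replicate (2 + k) c) (generic-not-∷-replicate k c) a c) (ξ-not-∷-replicate (suc k) c))
      (zeroOr-≡ (cong (λ v → ξ (5 + k) (v ∷ʳ b)) w≡) (right b))
      (trans (cong (ξ (4 + k)) w≡) (ξ-not-∷-replicate (2 + k) c))
    where
    w≡ : not c ∷ (replicate (2 + k) c ∷ʳ c) ≡ not c ∷ replicate (3 + k) c
    w≡ = cong (not c ∷_) (sym (replicate-∷ʳ (2 + k) c))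
    right : ∀ b → ZeroOr (sign c) (ξ (5 + k) (not c ∷ (replicate (3 + k) c ∷ʳ b)))
    right b with b ≟ᵇ c
    ... | yes refl = inj₂ (trans (cong (λ v → ξ (5 + k) (not c ∷ v)) (sym (replicate-∷ʳ (3 + k) c)))
                                 (ξ-not-∷-replicate (3 + k) c))
    ... | no b≢c rewrite ¬-not b≢c = inj₁ (ξ-not-∷-replicate-∷ʳ-not (2 + k) c)

  halves-generic : ∀ x (m : Str (2 + k)) y → Generic (x ∷ m) → Generic (m ∷ʳ y) → Halves (x ∷ (m ∷ʳ y))
  halves-generic x m y gen-xm gen-my a b =
    trans (cong₂ (λ p q → sgn (p ℤ.+ q)) (ih (x ∷ m) gen-xm a y) (ih (m ∷ʳ y) gen-my x b))
          (sym (ξ-step-∷-∷ʳ x m y (proj₁ gen-xm ∘ alternating-init (x ∷ m))))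

  halves-suffix : ∀ x (m : Str (2 + k)) y → Generic (x ∷ (m ∷ʳ y)) → Generic (x ∷ m) → Halves (x ∷ (m ∷ʳ y))
  halves-suffix x m y (¬alt , ¬const) gen-xm with alternating? (m ∷ʳ y) | constant? (m ∷ʳ y)
  ... | yes (z , eq) | _
    with refl , refl ← ∷ʳ-injective m (alt z (2 + k)) (trans eq (alt-∷ʳ z (2 + k)))
    with x ≟ᵇ z
  ...   | yes refl = halves-∷-alt x
  ...   | no x≢z = ⊥-elim (¬alt (x , cong (x ∷_) (trans (sym (alt-∷ʳ z (2 + k)))
                                                          (cong (λ q → alt q (3 + k)) (¬-not (x≢z ∘ sym))))))
  halves-suffix x m y (¬alt , ¬const) gen-xm | no _ | yes (c , eq)
    with refl , refl ← ∷ʳ-injective m (replicate (2 + k) c) (trans eq (replicate-∷ʳ (2 + k) c))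
    with x ≟ᵇ c
  ...   | yes refl = ⊥-elim (¬const (x , cong (x ∷_) (sym (replicate-∷ʳ (2 + k) x))))
  ...   | no x≢c rewrite ¬-not x≢c = halves-not-∷-replicate c
  halves-suffix x m y _ gen-xm | no ¬alt-my | no ¬const-my = halves-generic x m y gen-xm (¬alt-my , ¬const-my)

  halves : ∀ x (m : Str (2 + k)) y → Generic (x ∷ (m ∷ʳ y)) → Halves (x ∷ (m ∷ʳ y))
  halves x m y (¬alt , ¬const) with alternating? (x ∷ m) | constant? (x ∷ m)
  ... | yes (.x , refl) | _ with y ≟ᵇ lastAlt x (2 + k)
  ...   | yes refl = halves-alt-∷ʳ-last x
  ...   | no y≢ℓ = ⊥-elim (¬alt (x , cong (x ∷_) (trans (cong (alt (not x) (2 + k) ∷ʳ_) y≡)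
                                                           (sym (alt-∷ʳ (not x) (2 + k))))))
    where
    y≡ : y ≡ lastAlt (not x) (2 + k)
    y≡ = trans (¬-not y≢ℓ) (sym (lastAlt-not x (2 + k)))
  halves x m y (¬alt , ¬const) | no _ | yes (.x , refl) with y ≟ᵇ x
  ...   | yes refl = ⊥-elim (¬const (x , cong (x ∷_) (sym (replicate-∷ʳ (2 + k) x))))
  ...   | no y≢x rewrite ¬-not y≢x = halves-replicate-∷ʳ-not x
  halves x m y gen | no ¬alt-xm | no ¬const-xm = halves-suffix x m y gen (¬alt-xm , ¬const-xm)

  ξ-extend-step : ∀ (w : Str (4 + k)) → Generic w → ξ-Extendable w
  ξ-extend-step w gen a b with x , m , y , refl ← split-ends w =
    trans (ξ-step-∷-∷ʳ a w b (proj₁ gen ∘ alternating-init w ∘ alternating-tail)) (halves x m y gen a b)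

ξ-extend : ∀ k (w : Str (3 + k)) → Generic w → ξ-Extendable w
ξ-extend zero = ξ-extend-base
ξ-extend (suc k) = ξ-ExtendStep.ξ-extend-step k (ξ-extend k)

-- The function φ

φ-step : ∀ {n} (w : Str (suc n)) → ¬ Constant w → φ (suc n) w ≡ sgn (φ n (r w) ℤ.- φ n (l w))
φ-step {n} w ¬const with isOdd (suc n) | w ≟w replicate (suc n) false | w ≟w replicate (suc n) true
... | true  | yes w≡0s | _        = ⊥-elim (¬const (false , w≡0s))
... | true  | no _     | yes w≡1s = ⊥-elim (¬const (true , w≡1s))
... | true  | no _     | no _     = refl
... | false | _        | _        = refl

φ-step-∷-∷ʳ : ∀ {n} a (v : Str n) b → ¬ Constant (a ∷ (v ∷ʳ b)) →
              φ (2 + n) (a ∷ (v ∷ʳ b)) ≡ sgn (φ (suc n) (v ∷ʳ b) ℤ.- φ (suc n) (a ∷ v))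
φ-step-∷-∷ʳ {n} a v b ¬const =
  trans (φ-step (a ∷ (v ∷ʳ b)) ¬const)
        (cong (λ u → sgn (φ (suc n) (v ∷ʳ b) ℤ.- φ (suc n) u)) (init-∷-∷ʳ a v b))

φ-step-evenLength : ∀ {n} (w : Str (suc n)) → isOdd (suc n) ≡ false →
                    φ (suc n) w ≡ sgn (φ n (r w) ℤ.- φ n (l w))
φ-step-evenLength {n} w even-length with isOdd (suc n) | w ≟w replicate (suc n) false | w ≟w replicate (suc n) true
φ-step-evenLength w () | true | _ | _
... | false | _ | _ = refl

φ-replicate-oddLength : ∀ {n} c → isOdd (suc n) ≡ true → φ (suc n) (replicate (suc n) c) ≡ sign c
φ-replicate-oddLength {n} c odd
  with isOdd (suc n) | replicate (suc n) c ≟w replicate (suc n) false | replicate (suc n) c ≟w replicate (suc n) true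
φ-replicate-oddLength c () | false | _ | _
φ-replicate-oddLength false _ | true | yes _ | _ = refl
φ-replicate-oddLength false _ | true | no 0s≢0s | _ = ⊥-elim (0s≢0s refl)
φ-replicate-oddLength true _ | true | yes 1s≡0s | _ with () ← proj₁ (∷-injective 1s≡0s)
φ-replicate-oddLength true _ | true | no _ | yes _ = refl
φ-replicate-oddLength true _ | true | no _ | no 1s≢1s = ⊥-elim (1s≢1s refl)

φ-replicate : ∀ m c → φ m (replicate m c) ≡ (if even m then + 0 else sign c)
φ-replicate zero c = refl
φ-replicate (suc m) c with even m in ev
... | true = φ-replicate-oddLength c (trans (isOdd-suc m) ev)
... | false = begin
  φ (suc m) (replicate (suc m) c)
    ≡⟨ φ-step-evenLength (replicate (suc m) c) (trans (isOdd-suc m) ev) ⟩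
  sgn (φ m (replicate m c) ℤ.- φ m (init (replicate (suc m) c)))
    ≡⟨ cong (λ u → sgn (φ m (replicate m c) ℤ.- φ m u)) (init-replicate m c) ⟩
  sgn (φ m (replicate m c) ℤ.- φ m (replicate m c))
    ≡⟨ cong sgn (+-inverseʳ (φ m (replicate m c))) ⟩
  + 0 ∎
  where open ≡-Reasoning

φ-replicate-zeroOr : ∀ m c → ZeroOr (sign c) (φ m (replicate m c))
φ-replicate-zeroOr m c rewrite φ-replicate m c with even m
... | true  = inj₁ refl
... | false = inj₂ refl

φ-replicate-zeroOr-lastAlt : ∀ j c → ZeroOr (sign (not (lastAlt c j))) (φ (2 + j) (replicate (2 + j) c))
φ-replicate-zeroOr-lastAlt j c rewrite φ-replicate (2 + j) c | not-involutive (even j) | lastAlt≡if c j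
  with even j
... | true  = inj₁ refl
... | false = inj₂ (cong sign (sym (not-involutive c)))

φ-replicate-∷ʳ-not : ∀ j c → φ (2 + j) (replicate (1 + j) c ∷ʳ not c) ≡ sign (not c)
φ-replicate-∷ʳ-not zero true = refl
φ-replicate-∷ʳ-not zero false = refl
φ-replicate-∷ʳ-not (suc j) c = begin
  φ (3 + j) (c ∷ (replicate (1 + j) c ∷ʳ not c))
    ≡⟨ φ-step-∷-∷ʳ c (replicate (1 + j) c) (not c) (¬constant-replicate-∷ʳ-not (suc j) c) ⟩
  sgn (φ (2 + j) (replicate (1 + j) c ∷ʳ not c) ℤ.- φ (2 + j) (replicate (2 + j) c))
    ≡⟨ cong (λ a → sgn (a ℤ.- φ (2 + j) (replicate (2 + j) c))) (φ-replicate-∷ʳ-not j c) ⟩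
  sgn (sign (not c) ℤ.- φ (2 + j) (replicate (2 + j) c))
    ≡⟨ sgn-absorb-−ˡ c (φ-replicate-zeroOr (2 + j) c) ⟩
  sign (not c) ∎
  where open ≡-Reasoning

φ-not-∷-replicate : ∀ j c → φ (2 + j) (not c ∷ replicate (1 + j) c) ≡ sign (lastAlt c j)
φ-not-∷-replicate zero true = refl
φ-not-∷-replicate zero false = refl
φ-not-∷-replicate (suc j) c = begin
  φ (3 + j) (not c ∷ replicate (2 + j) c)
    ≡⟨ φ-step (not c ∷ replicate (2 + j) c) (¬constant-not-∷ c _) ⟩
  sgn (φ (2 + j) (replicate (2 + j) c) ℤ.- φ (2 + j) (not c ∷ init (replicate (2 + j) c)))
    ≡⟨ cong (λ u → sgn (φ (2 + j) (replicate (2 + j) c) ℤ.- φ (2 + j) (not c ∷ u))) (init-replicate (1 + j) c) ⟩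
  sgn (φ (2 + j) (replicate (2 + j) c) ℤ.- φ (2 + j) (not c ∷ replicate (1 + j) c))
    ≡⟨ cong (λ a → sgn (φ (2 + j) (replicate (2 + j) c) ℤ.- a)) (φ-not-∷-replicate j c) ⟩
  sgn (φ (2 + j) (replicate (2 + j) c) ℤ.- sign (lastAlt c j))
    ≡⟨ sgn-absorb-−ʳ (lastAlt c j) (φ-replicate-zeroOr-lastAlt j c) ⟩
  sign (not (lastAlt c j))
    ≡⟨ cong sign (lastAlt-not c j) ⟨
  sign (lastAlt c (1 + j)) ∎
  where open ≡-Reasoning

φ-not-∷-replicate-∷ʳ-not : ∀ j c → φ (3 + j) (not c ∷ (replicate (1 + j) c ∷ʳ not c))
                                    ≡ sgn (sign (not c) ℤ.- sign (lastAlt c j))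
φ-not-∷-replicate-∷ʳ-not j c =
  trans (φ-step-∷-∷ʳ (not c) (replicate (1 + j) c) (not c) (¬constant-not-∷ c _))
        (cong₂ (λ a b → sgn (a ℤ.- b)) (φ-replicate-∷ʳ-not j c) (φ-not-∷-replicate j c))

φ-alt : ∀ m x → φ (suc m) (alt x (suc m)) ≡ sign (lastAlt x m)
φ-alt zero true = refl
φ-alt zero false = refl
φ-alt (suc m) x = begin
  φ (2 + m) (alt x (2 + m))
    ≡⟨ φ-step (alt x (2 + m)) (¬constant-∷-not x _) ⟩
  sgn (φ (suc m) (alt (not x) (suc m)) ℤ.- φ (suc m) (init (alt x (2 + m))))
    ≡⟨ cong (λ u → sgn (φ (suc m) (alt (not x) (suc m)) ℤ.- φ (suc m) u)) (init-alt x (suc m)) ⟩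
  sgn (φ (suc m) (alt (not x) (suc m)) ℤ.- φ (suc m) (alt x (suc m)))
    ≡⟨ cong₂ (λ a b → sgn (a ℤ.- b)) (trans (φ-alt m (not x)) (cong sign (lastAlt-not x m))) (φ-alt m x) ⟩
  sgn (sign (not (lastAlt x m)) ℤ.- sign (lastAlt x m))
    ≡⟨ sgn-absorb-−ʳ (lastAlt x m) (inj₂ refl) ⟩
  sign (not (lastAlt x m)) ≡⟨ cong sign (lastAlt-not x m) ⟨
  sign (lastAlt (not x) m) ∎
  where open ≡-Reasoning

φ-Extendable : ∀ {n} → Str n → Set
φ-Extendable {n} w = ∀ a b → φ (2 + n) (a ∷ (w ∷ʳ b)) ≡ - φ n w

φ-extend-base : ∀ (w : Str 2) → ¬ Constant w → φ-Extendable w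
φ-extend-base (false ∷ false ∷ []) ¬const = ⊥-elim (¬const (false , refl))
φ-extend-base (true ∷ true ∷ []) ¬const = ⊥-elim (¬const (true , refl))
φ-extend-base (false ∷ true ∷ []) _ =
  λ { false false → refl ; false true → refl ; true false → refl ; true true → refl }
φ-extend-base (true ∷ false ∷ []) _ =
  λ { false false → refl ; false true → refl ; true false → refl ; true true → refl }

module φ-ExtendStep (k : ℕ) (ih : ∀ (w : Str (2 + k)) → ¬ Constant w → φ-Extendable w) where

  Halves : Str (3 + k) → Set
  Halves w = ∀ a b → sgn (φ (4 + k) (w ∷ʳ b) ℤ.- φ (4 + k) (a ∷ w)) ≡ - φ (3 + k) w

  halves-replicate-∷ʳ-not : ∀ x → Halves (replicate (2 + k) x ∷ʳ not x)
  halves-replicate-∷ʳ-not x a b = begin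
    sgn (φ (4 + k) (x ∷ ((replicate (1 + k) x ∷ʳ not x) ∷ʳ b)) ℤ.- φ (4 + k) (a ∷ w))
      ≡⟨ cong (λ p → sgn (p ℤ.- φ (4 + k) (a ∷ w))) right ⟩
    sgn (sign (not (not x)) ℤ.- φ (4 + k) (a ∷ w))
      ≡⟨ sgn-absorb-−ˡ (not x) (left a) ⟩
    sign (not (not x))
      ≡⟨ sign-not (not x) ⟩
    - sign (not x)
      ≡⟨ cong -_ (φ-replicate-∷ʳ-not (suc k) x) ⟨
    - φ (3 + k) w ∎
    where
    open ≡-Reasoning
    w = replicate (2 + k) x ∷ʳ not x
    right : φ (4 + k) (x ∷ ((replicate (1 + k) x ∷ʳ not x) ∷ʳ b)) ≡ sign (not (not x))
    right = begin
      φ (4 + k) (x ∷ ((replicate (1 + k) x ∷ʳ not x) ∷ʳ b))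
        ≡⟨ ih (replicate (1 + k) x ∷ʳ not x) (¬constant-replicate-∷ʳ-not k x) x b ⟩
      - φ (2 + k) (replicate (1 + k) x ∷ʳ not x)
        ≡⟨ cong -_ (φ-replicate-∷ʳ-not k x) ⟩
      - sign (not x)
        ≡⟨ sign-not (not x) ⟨
      sign (not (not x)) ∎
    left : ∀ a → ZeroOr (sign (not x)) (φ (4 + k) (a ∷ w))
    left a with a ≟ᵇ x
    ... | yes refl = inj₂ (φ-replicate-∷ʳ-not (2 + k) x)
    ... | no a≢x rewrite ¬-not a≢x =
      zeroOr-≡ (φ-not-∷-replicate-∷ʳ-not (suc k) x) (sgn-sign-−ˡ (not x) (lastAlt x (suc k)))

  halves-not-∷-replicate : ∀ c → Halves (not c ∷ (replicate (1 + k) c ∷ʳ c))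
  halves-not-∷-replicate c a b = begin
    sgn (φ (4 + k) (w ∷ʳ b) ℤ.- φ (4 + k) (a ∷ w))
      ≡⟨ cong (λ q → sgn (φ (4 + k) (w ∷ʳ b) ℤ.- q)) left ⟩
    sgn (φ (4 + k) (w ∷ʳ b) ℤ.- sign e)
      ≡⟨ sgn-absorb-−ʳ e (zeroOr-≡ (cong (λ v → φ (4 + k) (v ∷ʳ b)) w≡) (right b)) ⟩
    sign (not e)
      ≡⟨ sign-not e ⟩
    - sign e
      ≡⟨ cong -_ (trans (cong (φ (3 + k)) w≡) (φ-not-∷-replicate (suc k) c)) ⟨
    - φ (3 + k) w ∎
    where
    open ≡-Reasoning
    w = not c ∷ (replicate (1 + k) c ∷ʳ c)
    e = lastAlt c (suc k)
    w≡ : w ≡ not c ∷ replicate (2 + k) c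
    w≡ = cong (not c ∷_) (sym (replicate-∷ʳ (1 + k) c))
    left : φ (4 + k) (a ∷ w) ≡ sign e
    left = begin
      φ (4 + k) (a ∷ w)
        ≡⟨ ih (not c ∷ replicate (1 + k) c) (¬constant-not-∷ c _) a c ⟩
      - φ (2 + k) (not c ∷ replicate (1 + k) c)
        ≡⟨ cong -_ (φ-not-∷-replicate k c) ⟩
      - sign (lastAlt c k)
        ≡⟨ sign-not (lastAlt c k) ⟨
      sign (not (lastAlt c k))
        ≡⟨ cong sign (lastAlt-not c k) ⟨
      sign e ∎
    right : ∀ b → ZeroOr (sign (not e)) (φ (4 + k) (not c ∷ (replicate (2 + k) c ∷ʳ b)))
    right b with b ≟ᵇ c
    ... | yes refl = inj₂ (begin
      φ (4 + k) (not c ∷ (replicate (2 + k) c ∷ʳ c))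
        ≡⟨ cong (λ v → φ (4 + k) (not c ∷ v)) (replicate-∷ʳ (2 + k) c) ⟨
      φ (4 + k) (not c ∷ replicate (3 + k) c)
        ≡⟨ φ-not-∷-replicate (2 + k) c ⟩
      sign (lastAlt (not c) (suc k))
        ≡⟨ cong sign (lastAlt-not c (suc k)) ⟩
      sign (not e) ∎)
    ... | no b≢c rewrite ¬-not b≢c = zeroOr-≡ (φ-not-∷-replicate-∷ʳ-not (suc k) c) (sgn-sign-−ʳ (not c) e)

  halves-generic : ∀ x (m : Str (1 + k)) y → ¬ Constant (x ∷ m) → ¬ Constant (m ∷ʳ y) → Halves (x ∷ (m ∷ʳ y))
  halves-generic x m y ¬const-xm ¬const-my a b = begin
    sgn (φ (4 + k) (x ∷ ((m ∷ʳ y) ∷ʳ b)) ℤ.- φ (4 + k) (a ∷ ((x ∷ m) ∷ʳ y)))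
      ≡⟨ cong₂ (λ p q → sgn (p ℤ.- q)) (ih (m ∷ʳ y) ¬const-my x b) (ih (x ∷ m) ¬const-xm a y) ⟩
    sgn (- φ (2 + k) (m ∷ʳ y) ℤ.- - φ (2 + k) (x ∷ m))
      ≡⟨ sgn-neg-−-neg (φ (2 + k) (m ∷ʳ y)) (φ (2 + k) (x ∷ m)) ⟩
    - sgn (φ (2 + k) (m ∷ʳ y) ℤ.- φ (2 + k) (x ∷ m))
      ≡⟨ cong -_ (φ-step-∷-∷ʳ x m y (¬const-xm ∘ constant-init (x ∷ m))) ⟨
    - φ (3 + k) (x ∷ (m ∷ʳ y)) ∎
    where open ≡-Reasoning

  halves : ∀ x (m : Str (1 + k)) y → ¬ Constant (x ∷ (m ∷ʳ y)) → Halves (x ∷ (m ∷ʳ y))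
  halves x m y ¬const with constant? (x ∷ m)
  ... | yes (.x , refl) with y ≟ᵇ x
  ...   | yes refl = ⊥-elim (¬const (x , cong (x ∷_) (sym (replicate-∷ʳ (1 + k) x))))
  ...   | no y≢x rewrite ¬-not y≢x = halves-replicate-∷ʳ-not x
  halves x m y ¬const | no ¬const-xm with constant? (m ∷ʳ y)
  ... | yes (c , eq)
    with refl , refl ← ∷ʳ-injective m (replicate (1 + k) c) (trans eq (replicate-∷ʳ (1 + k) c))
    with x ≟ᵇ c
  ...   | yes refl = ⊥-elim (¬const (x , cong (x ∷_) (sym (replicate-∷ʳ (1 + k) x))))
  ...   | no x≢c rewrite ¬-not x≢c = halves-not-∷-replicate c
  halves x m y ¬const | no ¬const-xm | no ¬const-my = halves-generic x m y ¬const-xm ¬const-my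

  φ-extend-step : ∀ (w : Str (3 + k)) → ¬ Constant w → φ-Extendable w
  φ-extend-step w ¬const a b with x , m , y , refl ← split-ends w =
    trans (φ-step-∷-∷ʳ a w b (¬const ∘ constant-init w ∘ constant-tail)) (halves x m y ¬const a b)

φ-extend : ∀ k (w : Str (2 + k)) → ¬ Constant w → φ-Extendable w
φ-extend zero = φ-extend-base
φ-extend (suc k) = φ-ExtendStep.φ-extend-step k (φ-extend k)

-- Non-colourable strings

isZero : ℤ → Bool
isZero z = does (z ℤ.≟ + 0)

isZero-neg : ∀ z → isZero (- z) ≡ isZero z
isZero-neg (+ zero) = refl
isZero-neg (+ suc n) = refl
isZero-neg ℤ.-[1+ n ] = refl

isZero-sign : ∀ y → isZero (sign y) ≡ false
isZero-sign true = refl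
isZero-sign false = refl

nonColourable : ∀ n → Str n → Bool
nonColourable n w = isZero (ψ n w)

nonColourable-suc : ∀ {n} (w : Str (suc n)) →
                    nonColourable (suc n) w ≡ isZero (ξ (suc n) w) ∨ isZero (φ (suc n) w)
nonColourable-suc {n} w with ξ (suc n) w ℤ.≟ + 0 | φ (suc n) w ℤ.≟ + 0
... | yes ξ≡0 | _ = dec-true (ψ (suc n) w ℤ.≟ + 0) (cong (λ z → (z ℤ.^ suc n) ℤ.* φ (suc n) w) ξ≡0)
... | no _ | yes φ≡0 =
  dec-true (ψ (suc n) w ℤ.≟ + 0) (trans (cong (ξ (suc n) w ℤ.^ suc n ℤ.*_) φ≡0) (*-zeroʳ (ξ (suc n) w ℤ.^ suc n)))
... | no ξ≢0 | no φ≢0 = dec-false (ψ (suc n) w ℤ.≟ + 0) ψ≢0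
  where
  ψ≢0 : ψ (suc n) w ≢ + 0
  ψ≢0 ψ≡0 with i*j≡0⇒i≡0∨j≡0 (ξ (suc n) w ℤ.^ suc n) ψ≡0
  ... | inj₁ ξ^n≡0 = ξ≢0 (i^n≡0⇒i≡0 (ξ (suc n) w) (suc n) ξ^n≡0)
  ... | inj₂ φ≡0 = φ≢0 φ≡0

nonColourable-ξ≡0 : ∀ {n} (w : Str (suc n)) → ξ (suc n) w ≡ + 0 → nonColourable (suc n) w ≡ true
nonColourable-ξ≡0 w ξ≡0 rewrite nonColourable-suc w | ξ≡0 = refl

nonColourable-φ≡sign : ∀ {n} (w : Str (suc n)) y → φ (suc n) w ≡ sign y →
                       nonColourable (suc n) w ≡ isZero (ξ (suc n) w)
nonColourable-φ≡sign w y φ≡ rewrite nonColourable-suc w | φ≡ | isZero-sign y = ∨-identityʳ _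

nonColourable-signs : ∀ {n} (w : Str (suc n)) x y → ξ (suc n) w ≡ sign x → φ (suc n) w ≡ sign y →
                   nonColourable (suc n) w ≡ false
nonColourable-signs w x y ξ≡ φ≡ =
  trans (nonColourable-φ≡sign w y φ≡) (trans (cong isZero ξ≡) (isZero-sign x))

nonColourable-cong : ∀ {m n} (u : Str (suc m)) (w : Str (suc n)) →
                     ξ (suc m) u ≡ ξ (suc n) w → φ (suc m) u ≡ - φ (suc n) w →
                     nonColourable (suc m) u ≡ nonColourable (suc n) w
nonColourable-cong {m} {n} u w ξ≡ φ≡ = begin
  nonColourable (suc m) u
    ≡⟨ nonColourable-suc u ⟩
  isZero (ξ (suc m) u) ∨ isZero (φ (suc m) u)
    ≡⟨ cong₂ _∨_ (cong isZero ξ≡) (trans (cong isZero φ≡) (isZero-neg (φ (suc n) w))) ⟩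
  isZero (ξ (suc n) w) ∨ isZero (φ (suc n) w)
    ≡⟨ nonColourable-suc w ⟨
  nonColourable (suc n) w ∎
  where open ≡-Reasoning

nonColourable-extend-generic : ∀ k (w : Str (3 + k)) → Generic w → ∀ a b →
                               nonColourable (5 + k) (a ∷ (w ∷ʳ b)) ≡ nonColourable (3 + k) w
nonColourable-extend-generic k w gen a b =
  nonColourable-cong (a ∷ (w ∷ʳ b)) w (ξ-extend k w gen a b) (φ-extend (suc k) w (proj₂ gen) a b)

nonColourable-replicate : ∀ m c → nonColourable (suc m) (replicate (suc m) c) ≡ true
nonColourable-replicate m c = nonColourable-ξ≡0 (replicate (suc m) c) (ξ-replicate (suc m) c)

module ReplicateExtension (m : ℕ) where

  not-∷-replicate-∷ʳ : ∀ c → not c ∷ (replicate (suc m) c ∷ʳ c) ≡ not c ∷ replicate (2 + m) c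
  not-∷-replicate-∷ʳ c = cong (not c ∷_) (sym (replicate-∷ʳ (suc m) c))

  extend-same-same : ∀ c → nonColourable (3 + m) (c ∷ (replicate (suc m) c ∷ʳ c)) ≡ true
  extend-same-same c = nonColourable-ξ≡0 (c ∷ (replicate (suc m) c ∷ʳ c))
    (trans (cong (λ v → ξ (3 + m) (c ∷ v)) (sym (replicate-∷ʳ (suc m) c))) (ξ-replicate (3 + m) c))

  extend-same-not : ∀ c → nonColourable (3 + m) (c ∷ (replicate (suc m) c ∷ʳ not c)) ≡ false
  extend-same-not c = nonColourable-signs (c ∷ (replicate (suc m) c ∷ʳ not c)) (not c) (not c)
    (ξ-replicate-∷ʳ-not (suc m) c) (φ-replicate-∷ʳ-not (suc m) c)

  extend-not-same : ∀ c → nonColourable (3 + m) (not c ∷ (replicate (suc m) c ∷ʳ c)) ≡ false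
  extend-not-same c = nonColourable-signs (not c ∷ (replicate (suc m) c ∷ʳ c)) c (lastAlt c (suc m))
    (trans (cong (ξ (3 + m)) (not-∷-replicate-∷ʳ c)) (ξ-not-∷-replicate (suc m) c))
    (trans (cong (φ (3 + m)) (not-∷-replicate-∷ʳ c)) (φ-not-∷-replicate (suc m) c))

  extend-not-not : ∀ c → nonColourable (3 + m) (not c ∷ (replicate (suc m) c ∷ʳ not c)) ≡ true
  extend-not-not c =
    nonColourable-ξ≡0 (not c ∷ (replicate (suc m) c ∷ʳ not c)) (ξ-not-∷-replicate-∷ʳ-not m c)

  extend-cases : ∀ c a b → nonColourable (3 + m) (a ∷ (replicate (suc m) c ∷ʳ b)) ≡ does (a ≟ᵇ b)
  extend-cases false false false = extend-same-same false
  extend-cases false false true = extend-same-not false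
  extend-cases false true false = extend-not-same false
  extend-cases false true true = extend-not-not false
  extend-cases true true true = extend-same-same true
  extend-cases true true false = extend-same-not true
  extend-cases true false true = extend-not-same true
  extend-cases true false false = extend-not-not true

  nonColourable-replicate-extend : ∀ c a b → nonColourable (3 + m) (a ∷ (replicate (suc m) c ∷ʳ b))
                                               ≡ does (a ≟ᵇ b) ∧ nonColourable (suc m) (replicate (suc m) c)
  nonColourable-replicate-extend c a b =
    trans (extend-cases c a b)
          (trans (sym (∧-identityʳ (does (a ≟ᵇ b)))) (cong (does (a ≟ᵇ b) ∧_) (sym (nonColourable-replicate m c))))

module AltExtension (m : ℕ) where

  extend-both : ∀ x {q} → lastAlt x (1 + m) ≡ q → ξ (4 + m) (x ∷ (alt x (2 + m) ∷ʳ q)) ≡ sgn (sign (not x) ℤ.+ sign q)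
  extend-both x refl = ξ-∷-alt-∷ʳ-last m x

  extend-front : ∀ x {q} → lastAlt x (1 + m) ≡ q → ξ (4 + m) (x ∷ (alt x (2 + m) ∷ʳ not q)) ≡ sign (not x)
  extend-front x refl = trans (cong (λ v → ξ (4 + m) (x ∷ v)) (alt-∷ʳ-not-last (suc m) x)) (ξ-∷-alt (suc m) x)

  extend-back : ∀ x {q} → lastAlt x (1 + m) ≡ q → ξ (4 + m) (not x ∷ (alt x (2 + m) ∷ʳ q)) ≡ sign q
  extend-back x refl =
    subst (λ y → ξ (4 + m) (not x ∷ (alt y (2 + m) ∷ʳ lastAlt y (1 + m))) ≡ sign (lastAlt y (1 + m)))
          (not-involutive x) (ξ-alt-∷ʳ-last (suc m) (not x))

  extend-none : ∀ x {q} → lastAlt x (1 + m) ≡ q →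
                ξ (4 + m) (not x ∷ (alt x (2 + m) ∷ʳ not q)) ≡ (if even m then sign x else + 0)
  extend-none x refl = begin
    ξ (4 + m) (not x ∷ (alt x (2 + m) ∷ʳ not (lastAlt x (1 + m))))
      ≡⟨ cong (λ v → ξ (4 + m) (not x ∷ v)) (alt-∷ʳ-not-last (suc m) x) ⟩
    ξ (4 + m) (not x ∷ alt x (3 + m))
      ≡⟨ cong (ξ (4 + m)) (not-∷-alt x (3 + m)) ⟩
    ξ (4 + m) (alt (not x) (4 + m))
      ≡⟨ ξ-alt (2 + m) (not x) ⟩
    (if not (not (even m)) then sign (not (not x)) else + 0)
      ≡⟨ cong₂ (λ e y → if e then sign y else + 0) (not-involutive (even m)) (not-involutive x) ⟩
    (if even m then sign x else + 0) ∎
    where open ≡-Reasoning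

  last≡ : ∀ x {e} → even m ≡ e → lastAlt x (1 + m) ≡ (if e then not x else x)
  last≡ x ev = trans (lastAlt-suc≡if x m) (cong (λ e → if e then not x else x) ev)

  extend-none-isZero : ∀ x {e} → even m ≡ e →
                       isZero (ξ (4 + m) (not x ∷ (alt x (2 + m) ∷ʳ not (if e then not x else x))))
                         ≡ isZero (if e then sign x else + 0)
  extend-none-isZero x ev = trans (cong isZero (extend-none x (last≡ x ev))) (cong (λ e → isZero (if e then sign x else + 0)) ev)

  isZero-ξ-extend : ∀ x a b e → even m ≡ e → isZero (ξ (4 + m) (a ∷ (alt x (2 + m) ∷ʳ b)))
                                               ≡ does (a ≟ᵇ b) ∧ isZero (if e then sign (not x) else + 0)
  isZero-ξ-extend false false false true ev = cong isZero (extend-front false (last≡ false ev))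
  isZero-ξ-extend false false true true ev = cong isZero (extend-both false (last≡ false ev))
  isZero-ξ-extend false true false true ev = extend-none-isZero false ev
  isZero-ξ-extend false true true true ev = cong isZero (extend-back false (last≡ false ev))
  isZero-ξ-extend true true true true ev = cong isZero (extend-front true (last≡ true ev))
  isZero-ξ-extend true true false true ev = cong isZero (extend-both true (last≡ true ev))
  isZero-ξ-extend true false true true ev = extend-none-isZero true ev
  isZero-ξ-extend true false false true ev = cong isZero (extend-back true (last≡ true ev))
  isZero-ξ-extend false false false false ev = cong isZero (extend-both false (last≡ false ev))
  isZero-ξ-extend false false true false ev = cong isZero (extend-front false (last≡ false ev))
  isZero-ξ-extend false true false false ev = cong isZero (extend-back false (last≡ false ev))
  isZero-ξ-extend false true true false ev = extend-none-isZero false ev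
  isZero-ξ-extend true true true false ev = cong isZero (extend-both true (last≡ true ev))
  isZero-ξ-extend true true false false ev = cong isZero (extend-front true (last≡ true ev))
  isZero-ξ-extend true false true false ev = cong isZero (extend-back true (last≡ true ev))
  isZero-ξ-extend true false false false ev = extend-none-isZero true ev

  nonColourable-alt-extend : ∀ x a b → nonColourable (4 + m) (a ∷ (alt x (2 + m) ∷ʳ b))
                                      ≡ does (a ≟ᵇ b) ∧ nonColourable (2 + m) (alt x (2 + m))
  nonColourable-alt-extend x a b = begin
    nonColourable (4 + m) (a ∷ (alt x (2 + m) ∷ʳ b))
      ≡⟨ nonColourable-φ≡sign (a ∷ (alt x (2 + m) ∷ʳ b)) (not (lastAlt x (1 + m))) φ-extended ⟩
    isZero (ξ (4 + m) (a ∷ (alt x (2 + m) ∷ʳ b)))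
      ≡⟨ isZero-ξ-extend x a b (even m) refl ⟩
    does (a ≟ᵇ b) ∧ isZero (if even m then sign (not x) else + 0)
      ≡⟨ cong (λ z → does (a ≟ᵇ b) ∧ isZero z) (ξ-alt m x) ⟨
    does (a ≟ᵇ b) ∧ isZero (ξ (2 + m) (alt x (2 + m)))
      ≡⟨ cong (does (a ≟ᵇ b) ∧_) (nonColourable-φ≡sign (alt x (2 + m)) (lastAlt x (1 + m)) (φ-alt (suc m) x)) ⟨
    does (a ≟ᵇ b) ∧ nonColourable (2 + m) (alt x (2 + m)) ∎
    where
    open ≡-Reasoning
    φ-extended : φ (4 + m) (a ∷ (alt x (2 + m) ∷ʳ b)) ≡ sign (not (lastAlt x (1 + m)))
    φ-extended = trans (φ-extend m (alt x (2 + m)) (¬constant-∷-not x _) a b)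
                       (trans (cong -_ (φ-alt (suc m) x)) (sym (sign-not (lastAlt x (1 + m)))))

nonColourable-alt : ∀ m x → nonColourable (2 + m) (alt x (2 + m)) ≡ not (even m)
nonColourable-alt m x =
  trans (nonColourable-φ≡sign (alt x (2 + m)) (lastAlt x (1 + m)) (φ-alt (suc m) x))
        (trans (cong isZero (ξ-alt m x)) (isZero-if (even m) x))
  where
  isZero-if : ∀ e x → isZero (if e then sign (not x) else + 0) ≡ not e
  isZero-if true x = isZero-sign (not x)
  isZero-if false x = refl

nonColourable-extend-special : ∀ k (v : Str 2) a b →
  nonColourable (5 + k) (a ∷ ((v ++ specialTail (1 + k) v) ∷ʳ b))
    ≡ does (a ≟ᵇ b) ∧ nonColourable (3 + k) (v ++ specialTail (1 + k) v)
nonColourable-extend-special k (false ∷ false ∷ []) = ReplicateExtension.nonColourable-replicate-extend (2 + k) false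
nonColourable-extend-special k (false ∷ true ∷ []) = AltExtension.nonColourable-alt-extend (1 + k) false
nonColourable-extend-special k (true ∷ false ∷ []) = AltExtension.nonColourable-alt-extend (1 + k) true
nonColourable-extend-special k (true ∷ true ∷ []) = ReplicateExtension.nonColourable-replicate-extend (2 + k) true

-- Counting

toℕ : Bool → ℕ
toℕ false = 0
toℕ true = 1

sumStr : ∀ n → (Str n → ℕ) → ℕ
sumStr zero f = f []
sumStr (suc n) f = sumStr n (f ∘ (false ∷_)) + sumStr n (f ∘ (true ∷_))

sumStr-cong : ∀ n {f g : Str n → ℕ} → (∀ w → f w ≡ g w) → sumStr n f ≡ sumStr n g
sumStr-cong zero f≗g = f≗g []
sumStr-cong (suc n) f≗g = cong₂ _+_ (sumStr-cong n (f≗g ∘ (false ∷_))) (sumStr-cong n (f≗g ∘ (true ∷_)))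

sumStr-+ : ∀ n (f g : Str n → ℕ) → sumStr n (λ w → f w + g w) ≡ sumStr n f + sumStr n g
sumStr-+ zero f g = refl
sumStr-+ (suc n) f g =
  trans (cong₂ _+_ (sumStr-+ n (f ∘ (false ∷_)) (g ∘ (false ∷_))) (sumStr-+ n (f ∘ (true ∷_)) (g ∘ (true ∷_))))
        (interchange (sumStr n (f ∘ (false ∷_))) (sumStr n (g ∘ (false ∷_)))
                     (sumStr n (f ∘ (true ∷_))) (sumStr n (g ∘ (true ∷_))))

sumStr-∷ʳ : ∀ n (f : Str (suc n) → ℕ) → sumStr (suc n) f ≡ sumStr n (λ w → f (w ∷ʳ false) + f (w ∷ʳ true))
sumStr-∷ʳ zero f = refl
sumStr-∷ʳ (suc n) f = cong₂ _+_ (sumStr-∷ʳ n (f ∘ (false ∷_))) (sumStr-∷ʳ n (f ∘ (true ∷_)))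

sumStr-except : ∀ n (f g : Str n → ℕ) (p : Str n) → (∀ w → w ≢ p → f w ≡ g w) →
                sumStr n f + g p ≡ sumStr n g + f p
sumStr-except zero f g [] _ = +-comm (f []) (g [])
sumStr-except (suc n) f g (false ∷ p) agree = begin
  (f₀ + f₁) + g (false ∷ p)   ≡⟨ xy∙z≈xz∙y f₀ f₁ (g (false ∷ p)) ⟩
  (f₀ + g (false ∷ p)) + f₁   ≡⟨ cong₂ _+_ differ-here agree-there ⟩
  (g₀ + f (false ∷ p)) + g₁   ≡⟨ xy∙z≈xz∙y g₀ g₁ (f (false ∷ p)) ⟨
  (g₀ + g₁) + f (false ∷ p)   ∎
  where
  open ≡-Reasoning
  f₀ = sumStr n (f ∘ (false ∷_)); f₁ = sumStr n (f ∘ (true ∷_))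
  g₀ = sumStr n (g ∘ (false ∷_)); g₁ = sumStr n (g ∘ (true ∷_))
  differ-here = sumStr-except n _ _ p (λ w w≢p → agree (false ∷ w) (w≢p ∘ proj₂ ∘ ∷-injective))
  agree-there = sumStr-cong n (λ w → agree (true ∷ w) (λ ()))
sumStr-except (suc n) f g (true ∷ p) agree = begin
  (f₀ + f₁) + g (true ∷ p)    ≡⟨ +-assoc f₀ f₁ (g (true ∷ p)) ⟩
  f₀ + (f₁ + g (true ∷ p))    ≡⟨ cong₂ _+_ agree-there differ-here ⟩
  g₀ + (g₁ + f (true ∷ p))    ≡⟨ +-assoc g₀ g₁ (f (true ∷ p)) ⟨
  (g₀ + g₁) + f (true ∷ p)    ∎
  where
  open ≡-Reasoning
  f₀ = sumStr n (f ∘ (false ∷_)); f₁ = sumStr n (f ∘ (true ∷_))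
  g₀ = sumStr n (g ∘ (false ∷_)); g₁ = sumStr n (g ∘ (true ∷_))
  differ-here = sumStr-except n _ _ p (λ w w≢p → agree (true ∷ w) (w≢p ∘ proj₂ ∘ ∷-injective))
  agree-there = sumStr-cong n (λ w → agree (false ∷ w) (λ ()))

sumStr-except-per-prefix : ∀ m {n} (f g : Str (m + n) → ℕ) (p : Str m → Str n) →
                           (∀ v u → u ≢ p v → f (v ++ u) ≡ g (v ++ u)) →
                           sumStr (m + n) f + sumStr m (λ v → g (v ++ p v))
                             ≡ sumStr (m + n) g + sumStr m (λ v → f (v ++ p v))
sumStr-except-per-prefix zero f g p agree = sumStr-except _ f g (p []) (agree [])
sumStr-except-per-prefix (suc m) {n} f g p agree = begin
  (f₀ + f₁) + (g₀′ + g₁′)   ≡⟨ interchange f₀ f₁ g₀′ g₁′ ⟩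
  (f₀ + g₀′) + (f₁ + g₁′)   ≡⟨ cong₂ _+_ (sumStr-except-per-prefix m _ _ (p ∘ (false ∷_)) (agree ∘ (false ∷_)))
                                       (sumStr-except-per-prefix m _ _ (p ∘ (true ∷_)) (agree ∘ (true ∷_))) ⟩
  (g₀ + f₀′) + (g₁ + f₁′)   ≡⟨ interchange g₀ f₀′ g₁ f₁′ ⟩
  (g₀ + g₁) + (f₀′ + f₁′)   ∎
  where
  open ≡-Reasoning
  f₀ = sumStr (m + n) (f ∘ (false ∷_)); f₁ = sumStr (m + n) (f ∘ (true ∷_))
  g₀ = sumStr (m + n) (g ∘ (false ∷_)); g₁ = sumStr (m + n) (g ∘ (true ∷_))
  f₀′ = sumStr m (λ v → f (false ∷ (v ++ p (false ∷ v))))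
  f₁′ = sumStr m (λ v → f (true ∷ (v ++ p (true ∷ v))))
  g₀′ = sumStr m (λ v → g (false ∷ (v ++ p (false ∷ v))))
  g₁′ = sumStr m (λ v → g (true ∷ (v ++ p (true ∷ v))))

length-filter-map : ∀ {A B : Set} {P : Pred B 0ℓ} (P? : Decidable P) (f : A → B) xs →
                    length (filter P? (List.map f xs)) ≡ length (filter (P? ∘ f) xs)
length-filter-map P? f List.[] = refl
length-filter-map P? f (x List.∷ xs) with does (P? (f x))
... | true  = cong suc (length-filter-map P? f xs)
... | false = length-filter-map P? f xs

length-filter-allStr : ∀ n {P : Pred (Str n) 0ℓ} (P? : Decidable P) →
                       length (filter P? (allStr n)) ≡ sumStr n (toℕ ∘ does ∘ P?)
length-filter-allStr zero P? with does (P? [])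
... | true  = refl
... | false = refl
length-filter-allStr (suc n) P? = begin
  length (filter P? (List.map (false ∷_) (allStr n) List.++ List.map (true ∷_) (allStr n)))
    ≡⟨ cong length (filter-++ P? (List.map (false ∷_) (allStr n)) _) ⟩
  length (filter P? (List.map (false ∷_) (allStr n)) List.++ filter P? (List.map (true ∷_) (allStr n)))
    ≡⟨ length-++ (filter P? (List.map (false ∷_) (allStr n))) ⟩
  length (filter P? (List.map (false ∷_) (allStr n))) + length (filter P? (List.map (true ∷_) (allStr n)))
    ≡⟨ cong₂ _+_ (trans (length-filter-map P? (false ∷_) (allStr n)) (length-filter-allStr n (P? ∘ (false ∷_))))
                 (trans (length-filter-map P? (true ∷_) (allStr n)) (length-filter-allStr n (P? ∘ (true ∷_)))) ⟩
  sumStr (suc n) (toℕ ∘ does ∘ P?) ∎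
  where open ≡-Reasoning

K≡sumStr : ∀ n → K n ≡ sumStr n (toℕ ∘ nonColourable n)
K≡sumStr n = length-filter-allStr n (λ w → ψ n w ℤ.≟ + 0)

-- The number of non-colourable strings among the two constant and the two alternating strings
-- of length n >= 3.
specialCount : ℕ → ℕ
specialCount n = 2 + 2 * toℕ (not (even n))

specialCount-+2 : ∀ n → specialCount (2 + n) ≡ specialCount n
specialCount-+2 n = cong (λ e → 2 + 2 * toℕ (not e)) (not-involutive (even n))

four-extensions : ∀ A B C D Kn S → A + S ≡ Kn + S → B + S ≡ Kn + 0 → C + S ≡ Kn + 0 → D + S ≡ Kn + S →
                  (A + B) + (C + D) + 2 * S ≡ 4 * Kn
four-extensions A B C D Kn S eA eB eC eD = begin
  (A + B) + (C + D) + 2 * S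
    ≡⟨ solve 5 (λ A B C D S → (A :+ B) :+ (C :+ D) :+ con 2 :* S := (A :+ D) :+ ((B :+ S) :+ (C :+ S)))
               refl A B C D S ⟩
  (A + D) + ((B + S) + (C + S))
    ≡⟨ cong₂ _+_ (cong₂ _+_ (+-cancelʳ-≡ S A Kn eA) (+-cancelʳ-≡ S D Kn eD)) (cong₂ _+_ eB eC) ⟩
  (Kn + Kn) + ((Kn + 0) + (Kn + 0))
    ≡⟨ solve 1 (λ Kn → (Kn :+ Kn) :+ ((Kn :+ con 0) :+ (Kn :+ con 0)) := con 4 :* Kn) refl Kn ⟩
  4 * Kn ∎
  where open ≡-Reasoning

module Recurrence (k : ℕ) where

  special : Str 2 → Str (3 + k)
  special v = v ++ specialTail (1 + k) v

  specialNonColourable : ℕ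
  specialNonColourable = sumStr 2 (toℕ ∘ nonColourable (3 + k) ∘ special)

  extensionCount : Bool → Bool → ℕ
  extensionCount a b = sumStr (3 + k) (λ w → toℕ (nonColourable (5 + k) (a ∷ (w ∷ʳ b))))

  extensionCount-except : ∀ a b → extensionCount a b + specialNonColourable
                                    ≡ K (3 + k) + sumStr 2 (λ v → toℕ (does (a ≟ᵇ b) ∧ nonColourable (3 + k) (special v)))
  extensionCount-except a b = begin
    extensionCount a b + specialNonColourable
      ≡⟨ sumStr-except-per-prefix 2 f (toℕ ∘ nonColourable (3 + k)) (specialTail (1 + k)) agree ⟩
    sumStr (3 + k) (toℕ ∘ nonColourable (3 + k)) + sumStr 2 (f ∘ special)
      ≡⟨ cong₂ _+_ (sym (K≡sumStr (3 + k)))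
                   (sumStr-cong 2 (λ v → cong toℕ (nonColourable-extend-special k v a b))) ⟩
    K (3 + k) + sumStr 2 (λ v → toℕ (does (a ≟ᵇ b) ∧ nonColourable (3 + k) (special v))) ∎
    where
    open ≡-Reasoning
    f : Str (3 + k) → ℕ
    f w = toℕ (nonColourable (5 + k) (a ∷ (w ∷ʳ b)))
    agree : ∀ v u → u ≢ specialTail (1 + k) v → f (v ++ u) ≡ toℕ (nonColourable (3 + k) (v ++ u))
    agree v u u≢ = cong toℕ (nonColourable-extend-generic k (v ++ u) (generic-unless-special v u u≢) a b)

  K-split : K (5 + k) ≡ (extensionCount false false + extensionCount false true)
                        + (extensionCount true false + extensionCount true true)
  K-split = trans (K≡sumStr (5 + k)) (cong₂ _+_ (split-last false) (split-last true))
    where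
    split-last : ∀ a → sumStr (4 + k) (λ w → toℕ (nonColourable (5 + k) (a ∷ w)))
                         ≡ extensionCount a false + extensionCount a true
    split-last a = trans (sumStr-∷ʳ (3 + k) (λ w → toℕ (nonColourable (5 + k) (a ∷ w))))
                         (sumStr-+ (3 + k) (λ w → toℕ (nonColourable (5 + k) (a ∷ (w ∷ʳ false))))
                                           (λ w → toℕ (nonColourable (5 + k) (a ∷ (w ∷ʳ true)))))

  specialNonColourable≡ : specialNonColourable ≡ specialCount (3 + k)
  specialNonColourable≡ = begin
    (toℕ (nonColourable (3 + k) (replicate (3 + k) false)) + toℕ (nonColourable (3 + k) (alt false (3 + k))))
      + (toℕ (nonColourable (3 + k) (alt true (3 + k))) + toℕ (nonColourable (3 + k) (replicate (3 + k) true)))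
      ≡⟨ cong₂ _+_ (cong₂ _+_ (cong toℕ (nonColourable-replicate (2 + k) false)) (cong toℕ (nonColourable-alt (1 + k) false)))
                   (cong₂ _+_ (cong toℕ (nonColourable-alt (1 + k) true)) (cong toℕ (nonColourable-replicate (2 + k) true))) ⟩
    (1 + toℕ (not (even (1 + k)))) + (toℕ (not (even (1 + k))) + 1)
      ≡⟨ count (not (even (1 + k))) ⟩
    specialCount (1 + k)
      ≡⟨ specialCount-+2 (1 + k) ⟨
    specialCount (3 + k) ∎
    where
    open ≡-Reasoning
    count : ∀ b → (1 + toℕ b) + (toℕ b + 1) ≡ 2 + 2 * toℕ b
    count false = refl
    count true = refl

  K-recurrence : K (5 + k) + 2 * specialCount (3 + k) ≡ 4 * K (3 + k)
  K-recurrence = begin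
    K (5 + k) + 2 * specialCount (3 + k)
      ≡⟨ cong₂ (λ p q → p + 2 * q) K-split (sym specialNonColourable≡) ⟩
    (e false false + e false true) + (e true false + e true true) + 2 * specialNonColourable
      ≡⟨ four-extensions (e false false) (e false true) (e true false) (e true true) (K (3 + k)) specialNonColourable
           (extensionCount-except false false) (extensionCount-except false true)
           (extensionCount-except true false) (extensionCount-except true true) ⟩
    4 * K (3 + k) ∎
    where
    open ≡-Reasoning
    e = extensionCount

recurrence⇒closed-form : ∀ K′ K P S → K′ + 2 * S ≡ 4 * K → 6 * K ≡ P + 4 * S → 6 * K′ ≡ 2 * (2 * P) + 4 * S
recurrence⇒closed-form K′ K P S rec closed = +-cancelʳ-≡ (12 * S) (6 * K′) (2 * (2 * P) + 4 * S) (begin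
  6 * K′ + 12 * S              ≡⟨ solve 2 (λ K′ S → con 6 :* K′ :+ con 12 :* S := con 6 :* (K′ :+ con 2 :* S)) refl K′ S ⟩
  6 * (K′ + 2 * S)             ≡⟨ cong (6 *_) rec ⟩
  6 * (4 * K)                  ≡⟨ solve 1 (λ K → con 6 :* (con 4 :* K) := con 4 :* (con 6 :* K)) refl K ⟩
  4 * (6 * K)                  ≡⟨ cong (4 *_) closed ⟩
  4 * (P + 4 * S)              ≡⟨ solve 2 (λ P S → con 4 :* (P :+ con 4 :* S)
                                                  := (con 2 :* (con 2 :* P) :+ con 4 :* S) :+ con 12 :* S) refl P S ⟩
  2 * (2 * P) + 4 * S + 12 * S ∎)
  where open ≡-Reasoning

K-closed-form : ∀ n → 2 ≤ n → 6 * K n ≡ 2 ^ n + 4 * specialCount n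
K-closed-form 0 ()
K-closed-form 1 (s≤s ())
K-closed-form 2 _ = refl
K-closed-form 3 _ = refl
K-closed-form 4 _ = refl
K-closed-form (suc (suc (suc (suc (suc k))))) _ = begin
  6 * K (5 + k)
    ≡⟨ recurrence⇒closed-form (K (5 + k)) (K (3 + k)) (2 ^ (3 + k)) (specialCount (3 + k))
         (Recurrence.K-recurrence k) (K-closed-form (suc (suc (suc k))) (s≤s (s≤s z≤n))) ⟩
  2 ^ (5 + k) + 4 * specialCount (3 + k)
    ≡⟨ cong (λ s → 2 ^ (5 + k) + 4 * s) (specialCount-+2 (3 + k)) ⟨
  2 ^ (5 + k) + 4 * specialCount (5 + k) ∎
  where open ≡-Reasoning

corollary6p7 : (n : ℕ) → 2 ≤ n →
    ((2 ∣ n) → 6 * K n ≡ 2 ^ n + 8) × (¬ (2 ∣ n) → 6 * K n ≡ 2 ^ n + 16)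
corollary6p7 n 2≤n = closed-form-for-parity ∘ dec-true (2 ∣? n) , closed-form-for-parity ∘ dec-false (2 ∣? n)
  where
  closed-form-for-parity : ∀ {e} → does (2 ∣? n) ≡ e → 6 * K n ≡ 2 ^ n + 4 * (2 + 2 * toℕ (not e))
  closed-form-for-parity 2∣?n≡e =
    trans (K-closed-form n 2≤n)
          (cong (λ e → 2 ^ n + 4 * (2 + 2 * toℕ (not e))) (trans (even≡does-2∣? n) 2∣?n≡e))
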